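{- Let $n$ and $m$ be positive integers with $m\geq n+1$. The number of pointed $(n,m)$-lattice paths $\dot{P}$ with $PRML(\dot{P})=0$ is $\binom{m-1}{n}c_n$, where $c_n=\frac{1}{n+1}\binom{2n}{n}$.
   Context: An $(n,m)$-lattice path is a sequence $P=(x_1,y_1)(x_2,y_2)\cdots(x_{n+1},y_{n+1})$ of vectors in $\mathbb{Z}^2$ such that $1-n\leq y_i\leq 1$ for all $i$, $\sum_{i=1}^{n+1}y_i=1$, $1\leq x_i\leq m-1$ for all $i$, and $\sum_{i=1}^{n+1}x_i=m$. For such $P$ put $a_0=b_0=0$, $a_i=\sum_{j=1}^{i}y_j$, $b_i=\sum_{j=1}^{i}x_j$ for $1\leq i\leq n+1$. A minimum point of $P$ is a point $(b_i,a_i)$ with $a_i\leq a_j$ for all $j\in\{0,\ldots,n+1\}$; the rightmost minimum point is the minimum point with the largest $b_i$, and if it is $(b_i,a_i)$ then $RML(P)=b_i$. A pointed $(n,m)$-lattice path is a pair $\dot{P}=[P;j]$ with $P$ an $(n,m)$-lattice path and $0\leq j\leq x_{n+1}-1$; its pointed rightmost minimum length is $PRML(\dot{P})=RML(P)+j$. -}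

module Defs where

open import Data.Nat as ℕ using (ℕ; zero; suc; _∸_; _<_)
open import Data.Nat.Combinatorics using (_C_)
open import Data.Nat.DivMod using (_/_)
open import Data.Integer as ℤ using (ℤ; +_)
open import Data.Vec using (Vec; []; _∷_; map; zip; foldr; last)
open import Data.Vec.Relation.Unary.All using (All)
open import Data.Product using (_×_; _,_; proj₁)
open import Relation.Nullary using (yes; no)
open import Relation.Binary.PropositionalEquality using (_≡_)

catalan : ℕ → ℕ
catalan n = ((2 ℕ.* n) C n) / suc n

-- partial sums: entry i is the sum of the first i entries (i = 0 .. k)
psumℕ : {k : ℕ} → Vec ℕ k → Vec ℕ (suc k)
psumℕ [] = 0 ∷ []
psumℕ (x ∷ xs) = 0 ∷ map (λ z → x ℕ.+ z) (psumℕ xs)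

psumℤ : {k : ℕ} → Vec ℤ k → Vec ℤ (suc k)
psumℤ [] = + 0 ∷ []
psumℤ (y ∷ ys) = + 0 ∷ map (λ z → y ℤ.+ z) (psumℤ ys)

sumℤ : {k : ℕ} → Vec ℤ k → ℤ
sumℤ = foldr _ ℤ._+_ (+ 0)

record LatticePath (n m : ℕ) : Set where
  field
    xs : Vec ℕ (suc n)
    ys : Vec ℤ (suc n)
    ys-lo : All (λ y → (+ 1 ℤ.- + n) ℤ.≤ y) ys
    ys-hi : All (λ y → y ℤ.≤ + 1) ys
    ys-sum : sumℤ ys ≡ + 1
    xs-lo : All (λ x → 1 ℕ.≤ x) xs
    xs-hi : All (λ x → x ℕ.≤ m ∸ 1) xs
    xs-sum : Data.Vec.sum xs ≡ m

open LatticePath public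

points : {n m : ℕ} → LatticePath n m → Vec (ℕ × ℤ) (suc (suc n))
points P = zip (psumℕ (xs P)) (psumℤ (ys P))

-- scan the points left to right, keeping the last point whose height is
-- <= every height seen so far; the result is the rightmost minimum point
rightmostMin : {k : ℕ} → ℕ × ℤ → Vec (ℕ × ℤ) k → ℕ × ℤ
rightmostMin best [] = best
rightmostMin (b , a) ((b' , a') ∷ ps) with a' ℤ.≤? a
... | yes _ = rightmostMin (b' , a') ps
... | no _  = rightmostMin (b , a) ps

RML : {n m : ℕ} → LatticePath n m → ℕ
RML P with points P
... | p ∷ ps = proj₁ (rightmostMin p ps)

record PointedPath (n m : ℕ) : Set where
  constructor [_︔_,_]
  field
    path : LatticePath n m
    point : ℕ
    point< : point < last (xs path)

open PointedPath public

PRML : {n m : ℕ} → PointedPath n m → ℕ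
PRML Ṗ = RML (path Ṗ) ℕ.+ point Ṗ

-- Every x-step is positive, so the rightmost minimum of a path is the origin exactly when all
-- heights a₁, …, a_{n+1} are positive; PRML = 0 then forces j = 0, and the conditions on the
-- x-steps and on the y-steps no longer interact. The x-steps, each lowered by one, form a weak
-- composition of m - n - 1 into n + 1 parts, and there are C(m - 1, n) of those. Reading the
-- y-steps backwards and passing to the deficits kᵢ = 1 - yᵢ ≥ 0, positivity of the heights says
-- that every suffix of (kᵢ) has sum smaller than its length, the total being n over n + 1 entries.
-- Splitting on whether the first entry is zero gives Pascal's recurrence cut off at the diagonal;
-- its solution B(l, s) satisfies B(l, s)·(l + s) = (l - s)·C(l + s, s), and B(n + 1, n) = c_n.

module Submission where

open import Defs
open import Data.Nat using (ℕ; _≤_; _*_; _∸_; _+_)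
open import Data.Nat.Combinatorics using (_C_)
open import Data.Fin using (Fin)
open import Data.Product using (Σ)
open import Relation.Binary.PropositionalEquality using (_≡_)
open import Function.Bundles using (_↔_)

open import Axiom.UniquenessOfIdentityProofs using (module Decidable⇒UIP)
open import Data.Empty using (⊥-elim)
import Data.Fin as Fin
open import Data.Fin.Properties using (+↔⊎; *↔×)
open import Data.Integer as ℤ using (ℤ; 0ℤ; 1ℤ)
import Data.Integer.Properties as ℤ
import Data.Integer.Tactic.RingSolver as ℤ-Solver
open import Data.Nat using (suc; pred; _<_; _>_; _<?_; z≤n; s≤s; z<s; ≤-pred; >-nonZero)
open import Data.Nat.Combinatorics using (nCk+nC[k+1]≡[n+1]C[k+1]; nC1≡n; nCn≡1; nCk≡nC[n∸k])
open import Data.Nat.DivMod using (_/_; m*n/n≡m)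
open import Data.Nat.Properties
open import Algebra.Properties.CommutativeSemigroup +-commutativeSemigroup using (x∙yz≈y∙xz)
open import Data.Nat.Tactic.RingSolver using (solve-∀)
open import Data.Product using (_×_; _,_; proj₁; proj₂)
open import Data.Product.Function.NonDependent.Propositional using (_×-↔_; _×-⇔_)
open import Data.Sum using (_⊎_; inj₁; inj₂)
open import Data.Sum.Function.Propositional using (_⊎-↔_)
open import Data.Unit using (⊤; tt)
open import Data.Vec using (Vec; []; _∷_; sum; replicate; map; zip; tail; last; reverse; _∷ʳ_)
open import Data.Vec.Properties
  using (map-proj₁-zip; map-proj₂-zip; map-∷ʳ; map-∘; map-cong; map-id; reverse-∷; reverse-involutive)
open import Data.Vec.Relation.Unary.All as All using (All; []; _∷_)
open import Data.Vec.Relation.Unary.All.Properties using (map⁺; map⁻)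
open import Function.Bundles using (_⇔_; mk⇔; Equivalence; mk↔ₛ′)
open import Function.Properties.Inverse using (↔-trans; ↔-sym)
open import Relation.Binary.PropositionalEquality
  using (refl; sym; trans; cong; cong₂; subst; module ≡-Reasoning)
open import Relation.Nullary using (¬_; Irrelevant; yes; no)
open import Relation.Nullary.Negation using (contradiction)

module ⇔ = Equivalence
open ≡-Reasoning

×-irrelevant : {A B : Set} → Irrelevant A → Irrelevant B → Irrelevant (A × B)
×-irrelevant A-irr B-irr (a , b) (a′ , b′) = cong₂ _,_ (A-irr a a′) (B-irr b b′)

proj₁-injective : {A : Set} {P : A → Set} → (∀ a → Irrelevant (P a)) →
  {u v : Σ A P} → proj₁ u ≡ proj₁ v → u ≡ v
proj₁-injective P-irr {a , p} {.a , q} refl = cong (a ,_) (P-irr a p q)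

restrict↔ : {A B : Set} {P : A → Set} {Q : B → Set} →
  (∀ a → Irrelevant (P a)) → (∀ b → Irrelevant (Q b)) →
  (f : A → B) (g : B → A) → (∀ {a} → P a → Q (f a)) → (∀ {b} → Q b → P (g b)) →
  (∀ {a} → P a → g (f a) ≡ a) → (∀ {b} → Q b → f (g b) ≡ b) →
  Σ A P ↔ Σ B Q
restrict↔ P-irr Q-irr f g f-resp g-resp g∘f f∘g = mk↔ₛ′
  (λ (a , p) → f a , f-resp p) (λ (b , q) → g b , g-resp q)
  (λ (_ , q) → proj₁-injective Q-irr (f∘g q)) (λ (_ , p) → proj₁-injective P-irr (g∘f p))

unique↔Fin1 : {A : Set} (a : A) → (∀ b → a ≡ b) → A ↔ Fin 1
unique↔Fin1 a unique =
  mk↔ₛ′ (λ _ → Fin.zero) (λ _ → a) (λ { Fin.zero → refl ; (Fin.suc ()) }) unique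

empty↔Fin0 : {A : Set} → ¬ A → A ↔ Fin 0
empty↔Fin0 ¬a = mk↔ₛ′ (λ a → ⊥-elim (¬a a)) (λ ()) (λ ()) (λ a → ⊥-elim (¬a a))

⊎↔Fin+ : {A B : Set} {a b : ℕ} → A ↔ Fin a → B ↔ Fin b → (A ⊎ B) ↔ Fin (a + b)
⊎↔Fin+ A↔a B↔b = ↔-trans (A↔a ⊎-↔ B↔b) (↔-sym +↔⊎)

-- Binomial coefficients and ballot numbers

[k+1]*[n+1]C[k+1]≡[n+1]*nCk : ∀ n k → suc k * (suc n C suc k) ≡ suc n * (n C k)
[k+1]*[n+1]C[k+1]≡[n+1]*nCk 0       0       = refl
[k+1]*[n+1]C[k+1]≡[n+1]*nCk 0       (suc k) = *-zeroʳ (suc (suc k))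
[k+1]*[n+1]C[k+1]≡[n+1]*nCk (suc n) 0       =
  trans (+-identityʳ _) (trans (nC1≡n (suc (suc n))) (sym (*-identityʳ _)))
[k+1]*[n+1]C[k+1]≡[n+1]*nCk (suc n) (suc k) = begin
  suc k′ * (suc N C suc k′)                 ≡⟨ cong (suc k′ *_) (nCk+nC[k+1]≡[n+1]C[k+1] N k′) ⟨
  suc k′ * (N C k′ + N C suc k′)            ≡⟨ *-distribˡ-+ (suc k′) (N C k′) (N C suc k′) ⟩
  suc k′ * (N C k′) + suc k′ * (N C suc k′) ≡⟨ cong₂ (λ x y → (N C k′ + x) + y)
                                                 ([k+1]*[n+1]C[k+1]≡[n+1]*nCk n k)
                                                 ([k+1]*[n+1]C[k+1]≡[n+1]*nCk n k′) ⟩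
  (N C k′ + N * (n C k)) + N * (n C k′)     ≡⟨ +-assoc (N C k′) _ _ ⟩
  N C k′ + (N * (n C k) + N * (n C k′))     ≡⟨ cong (N C k′ +_) (*-distribˡ-+ N (n C k) (n C k′)) ⟨
  N C k′ + N * (n C k + n C k′)             ≡⟨ cong (λ x → N C k′ + N * x)
                                                 (nCk+nC[k+1]≡[n+1]C[k+1] n k) ⟩
  suc N * (N C k′)                          ∎
  where N = suc n; k′ = suc k

[k+1]*[n+1]C[k+1]+[n+1]*nC[k+1]≡[n+1]*[n+1]C[k+1] : ∀ n k →
  suc k * (suc n C suc k) + suc n * (n C suc k) ≡ suc n * (suc n C suc k)
[k+1]*[n+1]C[k+1]+[n+1]*nC[k+1]≡[n+1]*[n+1]C[k+1] n k = begin
  suc k * (suc n C suc k) + suc n * (n C suc k) ≡⟨ cong (_+ suc n * (n C suc k))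
                                                     ([k+1]*[n+1]C[k+1]≡[n+1]*nCk n k) ⟩
  suc n * (n C k) + suc n * (n C suc k)         ≡⟨ *-distribˡ-+ (suc n) (n C k) (n C suc k) ⟨
  suc n * (n C k + n C suc k)                   ≡⟨ cong (suc n *_) (nCk+nC[k+1]≡[n+1]C[k+1] n k) ⟩
  suc n * (suc n C suc k)                       ∎

m+[n+o]∸n≡m+o : ∀ m n o → m + (n + o) ∸ n ≡ m + o
m+[n+o]∸n≡m+o m n o = trans (+-∸-assoc m (m≤m+n n o)) (cong (m +_) (m+n∸m≡n n o))

ballot : ℕ → ℕ → ℕ
ballot 0       0       = 1
ballot 0       (suc s) = 0
ballot (suc l) 0       = 1
ballot (suc l) (suc s) with s <? l
... | yes _ = ballot l (suc s) + ballot (suc l) s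
... | no  _ = 0

-- Multiplied by N, the hypotheses and the two absorption identities reduce the claim
-- to a polynomial identity in d, e and (N + 1) C (d + 1).
ballot-formula-step : ∀ d e {b₁ b₂} → let l = suc d + e; N = l + suc d in
  b₁ * N ≡ e * (N C suc d) → b₂ * N ≡ suc (suc e) * (N C d) →
  (b₁ + b₂) * suc N ≡ suc e * (suc N C suc d)
ballot-formula-step d e {b₁} {b₂} h₁ h₂ = *-cancelˡ-≡ _ _ N {{>-nonZero N>0}} (begin
  N * ((b₁ + b₂) * suc N)                     ≡⟨ regroup N b₁ b₂ ⟩
  suc N * (b₁ * N + b₂ * N)                   ≡⟨ cong₂ (λ x y → suc N * (x + y)) h₁ h₂ ⟩
  suc N * (e * X + suc (suc e) * Y)           ≡⟨ distribute (suc N) e X Y ⟩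
  e * (suc N * X) + suc (suc e) * (suc N * Y) ≡⟨ cong₂ (λ x y → e * x + suc (suc e) * y)
                                                   [N+1]*X≡[l+1]*K [N+1]*Y≡[d+1]*K ⟩
  e * (suc l * K) + suc (suc e) * (suc d * K) ≡⟨ collect d e K ⟩
  N * (suc e * K)                             ∎)
  where
  l = suc d + e
  N = l + suc d
  X = N C suc d
  Y = N C d
  K = suc N C suc d
  N>0 : N > 0
  N>0 = ≤-trans (s≤s z≤n) (m≤n+m (suc d) l)
  [N+1]*Y≡[d+1]*K : suc N * Y ≡ suc d * K
  [N+1]*Y≡[d+1]*K = sym ([k+1]*[n+1]C[k+1]≡[n+1]*nCk N d)
  [N+1]*X≡[l+1]*K : suc N * X ≡ suc l * K
  [N+1]*X≡[l+1]*K = +-cancelˡ-≡ (suc d * K) _ _ (begin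
    suc d * K + suc N * X ≡⟨ [k+1]*[n+1]C[k+1]+[n+1]*nC[k+1]≡[n+1]*[n+1]C[k+1] N d ⟩
    suc N * K             ≡⟨ *-distribʳ-+ K (suc l) (suc d) ⟩
    suc l * K + suc d * K ≡⟨ +-comm (suc l * K) _ ⟩
    suc d * K + suc l * K ∎)
  regroup : ∀ N b₁ b₂ → N * ((b₁ + b₂) * suc N) ≡ suc N * (b₁ * N + b₂ * N)
  regroup = solve-∀
  distribute : ∀ M e X Y → M * (e * X + suc (suc e) * Y) ≡ e * (M * X) + suc (suc e) * (M * Y)
  distribute = solve-∀
  collect : ∀ d e K → e * (suc (suc d + e) * K) + suc (suc e) * (suc d * K)
                      ≡ (suc d + e + suc d) * (suc e * K)
  collect = solve-∀

ballot-formula-step-∸ : ∀ l d {b₁ b₂} → d < l →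
  b₁ * (l + suc d) ≡ (l ∸ suc d) * ((l + suc d) C suc d) →
  b₂ * (suc l + d) ≡ (suc l ∸ d) * ((suc l + d) C d) →
  (b₁ + b₂) * (suc l + suc d) ≡ (l ∸ d) * ((suc l + suc d) C suc d)
ballot-formula-step-∸ l d {b₁} {b₂} d<l h₁ h₂ with m≤n⇒∃[o]m+o≡n d<l
... | e , refl = subst (λ k → (b₁ + b₂) * (suc l + suc d) ≡ k * ((suc l + suc d) C suc d))
                   (sym (m+[n+o]∸n≡m+o 1 d e)) (ballot-formula-step d e {b₁} h₁′ h₂′)
  where
  h₁′ : b₁ * (l + suc d) ≡ e * ((l + suc d) C suc d)
  h₁′ = trans h₁ (cong (_* ((l + suc d) C suc d)) (m+[n+o]∸n≡m+o 0 d e))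
  h₂′ : b₂ * (l + suc d) ≡ suc (suc e) * ((l + suc d) C d)
  h₂′ = subst (λ M → b₂ * M ≡ suc (suc e) * (M C d)) (sym (+-suc l d))
          (trans h₂ (cong (_* ((suc l + d) C d)) (m+[n+o]∸n≡m+o 2 d e)))

ballot*[l+s]≡[l∸s]*[l+s]Cs : ∀ l s → ballot l s * (l + s) ≡ (l ∸ s) * ((l + s) C s)
ballot*[l+s]≡[l∸s]*[l+s]Cs 0       0       = refl
ballot*[l+s]≡[l∸s]*[l+s]Cs 0       (suc s) = refl
ballot*[l+s]≡[l∸s]*[l+s]Cs (suc l) 0       =
  trans (+-identityʳ _) (trans (cong suc (+-identityʳ l)) (sym (*-identityʳ _)))
ballot*[l+s]≡[l∸s]*[l+s]Cs (suc l) (suc s) with s <? l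
... | yes s<l = ballot-formula-step-∸ l s {ballot l (suc s)} s<l
                  (ballot*[l+s]≡[l∸s]*[l+s]Cs l (suc s)) (ballot*[l+s]≡[l∸s]*[l+s]Cs (suc l) s)
... | no  s≮l = sym (cong (_* ((suc l + suc s) C suc s)) (m≤n⇒m∸n≡0 (≮⇒≥ s≮l)))

ballot[1+n,n]*[1+n]≡[n+n]Cn : ∀ n → ballot (suc n) n * suc n ≡ (n + n) C n
ballot[1+n,n]*[1+n]≡[n+n]Cn n = *-cancelˡ-≡ _ _ (suc (n + n)) (begin
  suc (n + n) * (B * suc n)               ≡⟨ *-assoc (suc (n + n)) B (suc n) ⟨
  suc (n + n) * B * suc n                 ≡⟨ cong (_* suc n) (*-comm (suc (n + n)) B) ⟩
  B * suc (n + n) * suc n                 ≡⟨ cong (_* suc n) (ballot*[l+s]≡[l∸s]*[l+s]Cs (suc n) n) ⟩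
  (suc n ∸ n) * (suc (n + n) C n) * suc n ≡⟨ cong (λ k → k * (suc (n + n) C n) * suc n)
                                               (m+n∸n≡m 1 n) ⟩
  1 * (suc (n + n) C n) * suc n           ≡⟨ cong (_* suc n) (*-identityˡ (suc (n + n) C n)) ⟩
  (suc (n + n) C n) * suc n               ≡⟨ *-comm _ (suc n) ⟩
  suc n * (suc (n + n) C n)               ≡⟨ cong (suc n *_) symmetry ⟩
  suc n * (suc (n + n) C suc n)           ≡⟨ [k+1]*[n+1]C[k+1]≡[n+1]*nCk (n + n) n ⟩
  suc (n + n) * ((n + n) C n)             ∎)
  where
  B = ballot (suc n) n
  symmetry : suc (n + n) C n ≡ suc (n + n) C suc n
  symmetry = trans (nCk≡nC[n∸k] (≤-trans (m≤m+n n n) (n≤1+n (n + n))))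
                   (cong (suc (n + n) C_) (m+[n+o]∸n≡m+o 1 n n))

ballot[1+n,n]≡catalan : ∀ n → ballot (suc n) n ≡ catalan n
ballot[1+n,n]≡catalan n = begin
  ballot (suc n) n                 ≡⟨ m*n/n≡m (ballot (suc n) n) (suc n) ⟨
  ballot (suc n) n * suc n / suc n ≡⟨ cong (_/ suc n) (ballot[1+n,n]*[1+n]≡[n+n]Cn n) ⟩
  ((n + n) C n) / suc n            ≡⟨ cong (λ k → (k C n) / suc n) (cong (n +_) (+-identityʳ n)) ⟨
  catalan n                        ∎

-- Vectors of naturals with a given sum

sum-replicate-0 : ∀ l → sum (replicate l 0) ≡ 0
sum-replicate-0 0       = refl
sum-replicate-0 (suc l) = sum-replicate-0 l

sum≡0⇒replicate-0 : ∀ {l} (v : Vec ℕ l) → sum v ≡ 0 → replicate l 0 ≡ v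
sum≡0⇒replicate-0 []          _ = refl
sum≡0⇒replicate-0 (0 ∷ v)     p = cong (0 ∷_) (sum≡0⇒replicate-0 v p)
sum≡0⇒replicate-0 (suc _ ∷ _) ()

sum-map-suc : ∀ {l} (v : Vec ℕ l) → sum (map suc v) ≡ l + sum v
sum-map-suc []              = refl
sum-map-suc {suc l} (k ∷ v) = begin
  suc k + sum (map suc v) ≡⟨ cong (suc k +_) (sum-map-suc v) ⟩
  suc k + (l + sum v)     ≡⟨ cong suc (x∙yz≈y∙xz k l (sum v)) ⟩
  suc l + (k + sum v)     ∎

map-suc∘pred : ∀ {l} {v : Vec ℕ l} → All (1 ≤_) v → map suc (map pred v) ≡ v
map-suc∘pred []            = refl
map-suc∘pred (s≤s _ ∷ pos) = cong (_ ∷_) (map-suc∘pred pos)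

All-≤-sum : ∀ {l} (v : Vec ℕ l) → All (_≤ sum v) v
All-≤-sum []      = []
All-≤-sum (k ∷ v) =
  m≤m+n k (sum v) ∷ All.map (λ k′≤ → ≤-trans k′≤ (m≤n+m (sum v) k)) (All-≤-sum v)

Composition : ℕ → ℕ → Set
Composition l s = Σ (Vec ℕ l) (λ v → sum v ≡ s)

Composition-split : ∀ l s → Composition (suc l) (suc s) ↔ (Composition l (suc s) ⊎ Composition (suc l) s)
Composition-split l s = mk↔ₛ′ to from to∘from from∘to
  where
  to : Composition (suc l) (suc s) → Composition l (suc s) ⊎ Composition (suc l) s
  to (0     ∷ v , p) = inj₁ (v , p)
  to (suc k ∷ v , p) = inj₂ (k ∷ v , suc-injective p)
  from : Composition l (suc s) ⊎ Composition (suc l) s → Composition (suc l) (suc s)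
  from (inj₁ (v , p))     = 0 ∷ v , p
  from (inj₂ (k ∷ v , p)) = suc k ∷ v , cong suc p
  to∘from : ∀ c → to (from c) ≡ c
  to∘from (inj₁ _)           = refl
  to∘from (inj₂ (_ ∷ _ , _)) = cong inj₂ (proj₁-injective (λ _ → ≡-irrelevant) refl)
  from∘to : ∀ c → from (to c) ≡ c
  from∘to (0     ∷ _ , _) = refl
  from∘to (suc _ ∷ _ , _) = proj₁-injective (λ _ → ≡-irrelevant) refl

composition↔ : ∀ l s → Composition (suc l) s ↔ Fin ((l + s) C l)
composition↔ 0       s       = unique↔Fin1 (s ∷ [] , +-identityʳ s)
  λ { (k ∷ [] , p) →
      proj₁-injective (λ _ → ≡-irrelevant) (cong (_∷ []) (trans (sym p) (+-identityʳ k))) }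
composition↔ (suc l) 0       = subst (λ k → Composition (suc (suc l)) 0 ↔ Fin k) 1≡[l+1+0]C[l+1]
  (unique↔Fin1 (replicate (suc (suc l)) 0 , sum-replicate-0 (suc (suc l)))
    λ (v , p) → proj₁-injective (λ _ → ≡-irrelevant) (sum≡0⇒replicate-0 v p))
  where
  1≡[l+1+0]C[l+1] : 1 ≡ (suc l + 0) C suc l
  1≡[l+1+0]C[l+1] = sym (trans (cong (_C suc l) (+-identityʳ (suc l))) (nCn≡1 (suc l)))
composition↔ (suc l) (suc s) = ↔-trans (Composition-split (suc l) s)
  (subst (λ k → (Composition (suc l) (suc s) ⊎ Composition (suc (suc l)) s) ↔ Fin k) pascal
    (⊎↔Fin+ (composition↔ l (suc s)) (composition↔ (suc l) s)))
  where
  pascal : (l + suc s) C l + (suc l + s) C suc l ≡ (suc l + suc s) C suc l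
  pascal = begin
    (l + suc s) C l + suc (l + s) C suc l ≡⟨ cong (λ N → N C l + suc (l + s) C suc l) (+-suc l s) ⟩
    suc (l + s) C l + suc (l + s) C suc l ≡⟨ nCk+nC[k+1]≡[n+1]C[k+1] (suc (l + s)) l ⟩
    suc (suc (l + s)) C suc l             ≡⟨ cong (λ N → suc N C suc l) (+-suc l s) ⟨
    suc (l + suc s) C suc l               ∎

Ballot : ∀ {l} → Vec ℕ l → Set
Ballot []                = ⊤
Ballot {suc l} v@(_ ∷ w) = sum v < suc l × Ballot w

Ballot-irrelevant : ∀ {l} (v : Vec ℕ l) → Irrelevant (Ballot v)
Ballot-irrelevant []      _ _ = refl
Ballot-irrelevant (_ ∷ w)     = ×-irrelevant <-irrelevant (Ballot-irrelevant w)

Ballot-replicate-0 : ∀ l → Ballot (replicate l 0)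
Ballot-replicate-0 0       = tt
Ballot-replicate-0 (suc l) = subst (_< suc l) (sym (sum-replicate-0 l)) z<s , Ballot-replicate-0 l

BallotVec : ℕ → ℕ → Set
BallotVec l s = Σ (Vec ℕ l) (λ v → sum v ≡ s × Ballot v)

BallotVec-irrelevant : ∀ {l s} (v : Vec ℕ l) → Irrelevant (sum v ≡ s × Ballot v)
BallotVec-irrelevant v = ×-irrelevant ≡-irrelevant (Ballot-irrelevant v)

BallotVec-split : ∀ l s → s < l → BallotVec (suc l) (suc s) ↔ (BallotVec l (suc s) ⊎ BallotVec (suc l) s)
BallotVec-split l s s<l = mk↔ₛ′ to from to∘from from∘to
  where
  to : BallotVec (suc l) (suc s) → BallotVec l (suc s) ⊎ BallotVec (suc l) s
  to (0     ∷ v , p , _ , b) = inj₁ (v , p , b)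
  to (suc k ∷ v , p , _ , b) =
    inj₂ (k ∷ v , suc-injective p , subst (_< suc l) (sym (suc-injective p)) (m<n⇒m<1+n s<l) , b)
  from : BallotVec l (suc s) ⊎ BallotVec (suc l) s → BallotVec (suc l) (suc s)
  from (inj₁ (v , p , b))         = 0 ∷ v , p , subst (_< suc l) (sym p) (s≤s s<l) , b
  from (inj₂ (k ∷ v , p , _ , b)) =
    suc k ∷ v , cong suc p , subst (_< suc l) (sym (cong suc p)) (s≤s s<l) , b
  to∘from : ∀ c → to (from c) ≡ c
  to∘from (inj₁ _)           = cong inj₁ (proj₁-injective BallotVec-irrelevant refl)
  to∘from (inj₂ (_ ∷ _ , _)) = cong inj₂ (proj₁-injective BallotVec-irrelevant refl)
  from∘to : ∀ c → from (to c) ≡ c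
  from∘to (0     ∷ _ , _) = proj₁-injective BallotVec-irrelevant refl
  from∘to (suc _ ∷ _ , _) = proj₁-injective BallotVec-irrelevant refl

ballotVec↔ : ∀ l s → BallotVec l s ↔ Fin (ballot l s)
ballotVec↔ 0       0       = unique↔Fin1 ([] , refl , tt) λ { ([] , refl , tt) → refl }
ballotVec↔ 0       (suc s) = empty↔Fin0 λ { ([] , () , _) }
ballotVec↔ (suc l) 0       =
  unique↔Fin1 (replicate (suc l) 0 , sum-replicate-0 (suc l) , Ballot-replicate-0 (suc l))
    λ (v , p , _) → proj₁-injective BallotVec-irrelevant (sum≡0⇒replicate-0 v p)
ballotVec↔ (suc l) (suc s) with s <? l
... | yes s<l = ↔-trans (BallotVec-split l s s<l) (⊎↔Fin+ (ballotVec↔ l (suc s)) (ballotVec↔ (suc l) s))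
... | no  s≮l = empty↔Fin0 λ { (_ ∷ _ , p , b , _) → s≮l (≤-pred (subst (_< suc l) p b)) }

-- The rightmost minimum

All-zip-proj₁⁺ : ∀ {A B : Set} {P : A → Set} {k} (u : Vec A k) (w : Vec B k) →
  All P u → All (λ p → P (proj₁ p)) (zip u w)
All-zip-proj₁⁺ u w Pu = map⁻ (subst (All _) (sym (map-proj₁-zip u w)) Pu)

All-zip-proj₂⇔ : ∀ {A B : Set} {P : B → Set} {k} (u : Vec A k) (w : Vec B k) →
  All (λ p → P (proj₂ p)) (zip u w) ⇔ All P w
All-zip-proj₂⇔ u w = mk⇔ (λ P-zip → subst (All _) (map-proj₂-zip u w) (map⁺ P-zip))
                         (λ P-w → map⁻ (subst (All _) (sym (map-proj₂-zip u w)) P-w))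

rightmostMin-stays : ∀ {k} (ps : Vec (ℕ × ℤ) k) {b a} →
  All (λ p → a ℤ.< proj₂ p) ps → rightmostMin (b , a) ps ≡ (b , a)
rightmostMin-stays []               _              = refl
rightmostMin-stays ((_ , a′) ∷ ps) {a = a} (a<a′ ∷ above) with a′ ℤ.≤? a
... | yes a′≤a = contradiction a′≤a (ℤ.<⇒≱ a<a′)
... | no  _    = rightmostMin-stays ps above

rightmostMin-positive : ∀ {k} (ps : Vec (ℕ × ℤ) k) {b a} →
  All (λ p → 1 ≤ proj₁ p) ps → 1 ≤ b → 1 ≤ proj₁ (rightmostMin (b , a) ps)
rightmostMin-positive []               _              1≤b = 1≤b
rightmostMin-positive ((_ , a′) ∷ ps) {a = a} (1≤b′ ∷ pos) 1≤b with a′ ℤ.≤? a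
... | yes _ = rightmostMin-positive ps pos 1≤b′
... | no  _ = rightmostMin-positive ps pos 1≤b

rightmostMin≡0⇒above : ∀ {k} (ps : Vec (ℕ × ℤ) k) {a} → All (λ p → 1 ≤ proj₁ p) ps →
  proj₁ (rightmostMin (0 , a) ps) ≡ 0 → All (λ p → a ℤ.< proj₂ p) ps
rightmostMin≡0⇒above []               _              _ = []
rightmostMin≡0⇒above ((_ , a′) ∷ ps) {a} (1≤b′ ∷ pos) e with a′ ℤ.≤? a
... | yes _    = contradiction (subst (1 ≤_) e (rightmostMin-positive ps pos 1≤b′)) λ ()
... | no  a′≰a = ℤ.≰⇒> a′≰a ∷ rightmostMin≡0⇒above ps pos e

PositivePrefixSums : ∀ {k} → Vec ℤ k → Set
PositivePrefixSums v = All (0ℤ ℤ.<_) (tail (psumℤ v))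

PositivePrefixSums-irrelevant : ∀ {k} (v : Vec ℤ k) → Irrelevant (PositivePrefixSums v)
PositivePrefixSums-irrelevant _ = All.irrelevant ℤ.<-irrelevant

RML≡0⇔PositivePrefixSums : ∀ {n m} (P : LatticePath n m) → RML P ≡ 0 ⇔ PositivePrefixSums (ys P)
RML≡0⇔PositivePrefixSums record { xs = x ∷ v ; ys = y ∷ w ; xs-lo = 1≤x ∷ _ } = mk⇔
  (λ e → ⇔.to (All-zip-proj₂⇔ b a)
           (rightmostMin≡0⇒above (zip b a) (All-zip-proj₁⁺ b a b-positive) e))
  (λ above → cong proj₁ (rightmostMin-stays (zip b a) (⇔.from (All-zip-proj₂⇔ b a) above)))
  where
  b = map (λ z → x + z) (psumℕ v)
  a = map (λ z → y ℤ.+ z) (psumℤ w)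
  b-positive : All (1 ≤_) b
  b-positive = map⁺ (All.universal (λ z → ≤-trans 1≤x (m≤m+n x z)) (psumℕ v))

-- Prefix sums of a reversed vector

sumℤ-∷ʳ : ∀ {k} (u : Vec ℤ k) y → sumℤ (u ∷ʳ y) ≡ sumℤ u ℤ.+ y
sumℤ-∷ʳ []      y = trans (ℤ.+-identityʳ y) (sym (ℤ.+-identityˡ y))
sumℤ-∷ʳ (x ∷ u) y = trans (cong (ℤ._+_ x) (sumℤ-∷ʳ u y)) (sym (ℤ.+-assoc x (sumℤ u) y))

sumℤ-reverse : ∀ {k} (u : Vec ℤ k) → sumℤ (reverse u) ≡ sumℤ u
sumℤ-reverse []      = refl
sumℤ-reverse (x ∷ u) = begin
  sumℤ (reverse (x ∷ u)) ≡⟨ cong sumℤ (reverse-∷ x u) ⟩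
  sumℤ (reverse u ∷ʳ x)  ≡⟨ sumℤ-∷ʳ (reverse u) x ⟩
  sumℤ (reverse u) ℤ.+ x ≡⟨ cong (ℤ._+ x) (sumℤ-reverse u) ⟩
  sumℤ u ℤ.+ x           ≡⟨ ℤ.+-comm (sumℤ u) x ⟩
  sumℤ (x ∷ u)           ∎

psumℤ≡0∷tail : ∀ {k} (u : Vec ℤ k) → psumℤ u ≡ 0ℤ ∷ tail (psumℤ u)
psumℤ≡0∷tail []      = refl
psumℤ≡0∷tail (_ ∷ _) = refl

tail-psumℤ-∷ʳ : ∀ {k} (u : Vec ℤ k) y →
  tail (psumℤ (u ∷ʳ y)) ≡ tail (psumℤ u) ∷ʳ (sumℤ u ℤ.+ y)
tail-psumℤ-∷ʳ []      y = cong (_∷ []) (trans (ℤ.+-identityʳ y) (sym (ℤ.+-identityˡ y)))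
tail-psumℤ-∷ʳ (x ∷ u) y = begin
  map (ℤ._+_ x) (psumℤ (u ∷ʳ y))
    ≡⟨ cong (map (ℤ._+_ x)) (psumℤ≡0∷tail (u ∷ʳ y)) ⟩
  (x ℤ.+ 0ℤ) ∷ map (ℤ._+_ x) (tail (psumℤ (u ∷ʳ y)))
    ≡⟨ cong (λ t → (x ℤ.+ 0ℤ) ∷ map (ℤ._+_ x) t) (tail-psumℤ-∷ʳ u y) ⟩
  (x ℤ.+ 0ℤ) ∷ map (ℤ._+_ x) (tail (psumℤ u) ∷ʳ (sumℤ u ℤ.+ y))
    ≡⟨ cong ((x ℤ.+ 0ℤ) ∷_) (map-∷ʳ (ℤ._+_ x) _ (tail (psumℤ u))) ⟩
  (x ℤ.+ 0ℤ) ∷ (map (ℤ._+_ x) (tail (psumℤ u)) ∷ʳ (x ℤ.+ (sumℤ u ℤ.+ y)))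
    ≡⟨ cong (λ t → (x ℤ.+ 0ℤ) ∷ (map (ℤ._+_ x) (tail (psumℤ u)) ∷ʳ t))
            (ℤ.+-assoc x (sumℤ u) y) ⟨
  map (ℤ._+_ x) (0ℤ ∷ tail (psumℤ u)) ∷ʳ (x ℤ.+ sumℤ u ℤ.+ y)
    ≡⟨ cong (λ t → map (ℤ._+_ x) t ∷ʳ (x ℤ.+ sumℤ u ℤ.+ y)) (psumℤ≡0∷tail u) ⟨
  map (ℤ._+_ x) (psumℤ u) ∷ʳ (x ℤ.+ sumℤ u ℤ.+ y)
    ∎

module _ {A : Set} {P : A → Set} where

  All-∷ʳ⁺ : ∀ {k} {u : Vec A k} {x} → All P u → P x → All P (u ∷ʳ x)
  All-∷ʳ⁺ []         px = px ∷ []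
  All-∷ʳ⁺ (pu ∷ pus) px = pu ∷ All-∷ʳ⁺ pus px

  All-∷ʳ⁻ : ∀ {k} (u : Vec A k) {x} → All P (u ∷ʳ x) → All P u × P x
  All-∷ʳ⁻ []      (px ∷ [])  = [] , px
  All-∷ʳ⁻ (_ ∷ u) (pu ∷ pus) = let pus′ , px = All-∷ʳ⁻ u pus in pu ∷ pus′ , px

  All-reverse⁺ : ∀ {k} {u : Vec A k} → All P u → All P (reverse u)
  All-reverse⁺ {u = []}    []         = []
  All-reverse⁺ {u = x ∷ u} (px ∷ pus) =
    subst (All P) (sym (reverse-∷ x u)) (All-∷ʳ⁺ (All-reverse⁺ pus) px)

PositiveSuffixSums : ∀ {k} → Vec ℤ k → Set
PositiveSuffixSums []        = ⊤
PositiveSuffixSums v@(_ ∷ w) = 0ℤ ℤ.< sumℤ v × PositiveSuffixSums w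

PositiveSuffixSums-irrelevant : ∀ {k} (v : Vec ℤ k) → Irrelevant (PositiveSuffixSums v)
PositiveSuffixSums-irrelevant []      _ _ = refl
PositiveSuffixSums-irrelevant (_ ∷ w)     = ×-irrelevant ℤ.<-irrelevant (PositiveSuffixSums-irrelevant w)

PositivePrefixSums-reverse⇔ : ∀ {k} (r : Vec ℤ k) → PositivePrefixSums (reverse r) ⇔ PositiveSuffixSums r
PositivePrefixSums-reverse⇔ []      = mk⇔ (λ _ → tt) (λ _ → [])
PositivePrefixSums-reverse⇔ (y ∷ r) = mk⇔
  (λ pos → let pos-r , pos-total = All-∷ʳ⁻ _ (subst (All _) prefixes pos)
           in subst (0ℤ ℤ.<_) total pos-total , ⇔.to (PositivePrefixSums-reverse⇔ r) pos-r)
  (λ (pos-total , pos-r) → subst (All _) (sym prefixes)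
     (All-∷ʳ⁺ (⇔.from (PositivePrefixSums-reverse⇔ r) pos-r) (subst (0ℤ ℤ.<_) (sym total) pos-total)))
  where
  prefixes : tail (psumℤ (reverse (y ∷ r))) ≡ tail (psumℤ (reverse r)) ∷ʳ (sumℤ (reverse r) ℤ.+ y)
  prefixes = trans (cong (λ v → tail (psumℤ v)) (reverse-∷ y r)) (tail-psumℤ-∷ʳ (reverse r) y)
  total : sumℤ (reverse r) ℤ.+ y ≡ sumℤ (y ∷ r)
  total = trans (cong (ℤ._+ y) (sumℤ-reverse r)) (ℤ.+-comm (sumℤ r) y)

-- Heights and their deficits

i+k≡j+k⇒i≡j : ∀ {i j} k → i ℤ.+ k ≡ j ℤ.+ k → i ≡ j
i+k≡j+k⇒i≡j {i} {j} k eq = begin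
  i             ≡⟨ i≡i+k-k i k ⟩
  i ℤ.+ k ℤ.- k ≡⟨ cong (ℤ._- k) eq ⟩
  j ℤ.+ k ℤ.- k ≡⟨ i≡i+k-k j k ⟨
  j             ∎
  where
  i≡i+k-k : ∀ i k → i ≡ i ℤ.+ k ℤ.- k
  i≡i+k-k = ℤ-Solver.solve-∀

0<i⇔m<n : ∀ {i m n} → i ℤ.+ ℤ.+ m ≡ ℤ.+ n → 0ℤ ℤ.< i ⇔ m < n
0<i⇔m<n {i} {m} {n} eq = mk⇔
  (λ 0<i → ℤ.drop‿+<+ (subst (ℤ.+ m ℤ.<_) eq (ℤ.+-monoˡ-< (ℤ.+ m) 0<i)))
  (λ m<n → ℤ.≰⇒> λ i≤0 →
     ℤ.<⇒≱ (ℤ.+<+ m<n) (subst (ℤ._≤ ℤ.+ m) eq (ℤ.+-monoˡ-≤ (ℤ.+ m) i≤0)))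

deficit : ℤ → ℕ
deficit y = ℤ.∣ 1ℤ ℤ.- y ∣

ofDeficit : ℕ → ℤ
ofDeficit k = 1ℤ ℤ.- ℤ.+ k

ofDeficit∘deficit : ∀ {y} → y ℤ.≤ 1ℤ → ofDeficit (deficit y) ≡ y
ofDeficit∘deficit {y} y≤1 =
  trans (cong (ℤ._-_ 1ℤ) (ℤ.0≤i⇒+∣i∣≡i (ℤ.i≤j⇒0≤j-i y≤1))) (1-[1-y]≡y y)
  where
  1-[1-y]≡y : ∀ y → 1ℤ ℤ.- (1ℤ ℤ.- y) ≡ y
  1-[1-y]≡y = ℤ-Solver.solve-∀

deficit∘ofDeficit : ∀ k → deficit (ofDeficit k) ≡ k
deficit∘ofDeficit k = cong ℤ.∣_∣ (1-[1-k]≡k (ℤ.+ k))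
  where
  1-[1-k]≡k : ∀ k → 1ℤ ℤ.- (1ℤ ℤ.- k) ≡ k
  1-[1-k]≡k = ℤ-Solver.solve-∀

map-ofDeficit∘deficit : ∀ {l} {v : Vec ℤ l} → All (ℤ._≤ 1ℤ) v → map ofDeficit (map deficit v) ≡ v
map-ofDeficit∘deficit []         = refl
map-ofDeficit∘deficit (y≤1 ∷ ≤1) = cong₂ _∷_ (ofDeficit∘deficit y≤1) (map-ofDeficit∘deficit ≤1)

map-deficit∘ofDeficit : ∀ {l} (ks : Vec ℕ l) → map deficit (map ofDeficit ks) ≡ ks
map-deficit∘ofDeficit ks =
  trans (sym (map-∘ deficit ofDeficit ks)) (trans (map-cong deficit∘ofDeficit ks) (map-id ks))

sumℤ-map-ofDeficit : ∀ {l} (ks : Vec ℕ l) → sumℤ (map ofDeficit ks) ℤ.+ ℤ.+ sum ks ≡ ℤ.+ l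
sumℤ-map-ofDeficit []               = refl
sumℤ-map-ofDeficit {suc l} (k ∷ ks) = begin
  ofDeficit k ℤ.+ S ℤ.+ ℤ.+ (k + sum ks)       ≡⟨ cong (ℤ._+_ (ofDeficit k ℤ.+ S)) (ℤ.pos-+ k (sum ks)) ⟩
  ofDeficit k ℤ.+ S ℤ.+ (ℤ.+ k ℤ.+ ℤ.+ sum ks) ≡⟨ regroup (ℤ.+ k) S (ℤ.+ sum ks) ⟩
  1ℤ ℤ.+ (S ℤ.+ ℤ.+ sum ks)                    ≡⟨ cong (ℤ._+_ 1ℤ) (sumℤ-map-ofDeficit ks) ⟩
  ℤ.+ suc l                                    ∎
  where
  S = sumℤ (map ofDeficit ks)
  regroup : ∀ k S t → 1ℤ ℤ.- k ℤ.+ S ℤ.+ (k ℤ.+ t) ≡ 1ℤ ℤ.+ (S ℤ.+ t)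
  regroup = ℤ-Solver.solve-∀

PositiveSuffixSums-ofDeficit⇔Ballot : ∀ {l} (ks : Vec ℕ l) →
  PositiveSuffixSums (map ofDeficit ks) ⇔ Ballot ks
PositiveSuffixSums-ofDeficit⇔Ballot []       = mk⇔ (λ _ → tt) (λ _ → tt)
PositiveSuffixSums-ofDeficit⇔Ballot (k ∷ ks) =
  0<i⇔m<n (sumℤ-map-ofDeficit (k ∷ ks)) ×-⇔ PositiveSuffixSums-ofDeficit⇔Ballot ks

-- Counting the steps of a path

All-last : ∀ {A : Set} {P : A → Set} {k} {v : Vec A (suc k)} → All P v → P (last v)
All-last {v = _ ∷ []}    (p ∷ [])         = p
All-last {v = _ ∷ _ ∷ _} (_ ∷ ps@(_ ∷ _)) = All-last ps

HeightConditions : (n : ℕ) → (Vec ℤ (suc n) → Set) → Vec ℤ (suc n) → Set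
HeightConditions n Good v = All ((1ℤ ℤ.- ℤ.+ n) ℤ.≤_) v × All (ℤ._≤ 1ℤ) v × sumℤ v ≡ 1ℤ × Good v

Heights : (n : ℕ) → (Vec ℤ (suc n) → Set) → Set
Heights n Good = Σ (Vec ℤ (suc n)) (HeightConditions n Good)

HeightConditions-irrelevant : ∀ {n Good} → (∀ v → Irrelevant (Good v)) →
  ∀ v → Irrelevant (HeightConditions n Good v)
HeightConditions-irrelevant Good-irr v =
  ×-irrelevant (All.irrelevant ℤ.≤-irrelevant) (×-irrelevant (All.irrelevant ℤ.≤-irrelevant)
    (×-irrelevant (Decidable⇒UIP.≡-irrelevant ℤ._≟_) (Good-irr v)))

reverse-heights↔ : ∀ n → Heights n PositivePrefixSums ↔ Heights n PositiveSuffixSums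
reverse-heights↔ n = restrict↔
  (HeightConditions-irrelevant PositivePrefixSums-irrelevant)
  (HeightConditions-irrelevant PositiveSuffixSums-irrelevant)
  reverse reverse
  (λ {v} (lo , hi , Σ≡1 , pos) → All-reverse⁺ lo , All-reverse⁺ hi , trans (sumℤ-reverse v) Σ≡1 ,
     ⇔.to (PositivePrefixSums-reverse⇔ (reverse v))
          (subst PositivePrefixSums (sym (reverse-involutive v)) pos))
  (λ {v} (lo , hi , Σ≡1 , pos) → All-reverse⁺ lo , All-reverse⁺ hi , trans (sumℤ-reverse v) Σ≡1 ,
     ⇔.from (PositivePrefixSums-reverse⇔ v) pos)
  (λ _ → reverse-involutive _) (λ _ → reverse-involutive _)

deficit-heights↔ : ∀ n → Heights n PositiveSuffixSums ↔ BallotVec (suc n) n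
deficit-heights↔ n = restrict↔
  (HeightConditions-irrelevant PositiveSuffixSums-irrelevant) BallotVec-irrelevant
  (map deficit) (map ofDeficit) to-ballot from-ballot
  (λ (_ , hi , _) → map-ofDeficit∘deficit hi) (λ _ → map-deficit∘ofDeficit _)
  where
  to-ballot : ∀ {v} → HeightConditions n PositiveSuffixSums v →
    sum (map deficit v) ≡ n × Ballot (map deficit v)
  to-ballot {v} (_ , hi , Σ≡1 , pos) =
    suc-injective (ℤ.+-injective (trans (cong (ℤ._+ ℤ.+ sum ks) (sym S≡1)) (sumℤ-map-ofDeficit ks))) ,
    ⇔.to (PositiveSuffixSums-ofDeficit⇔Ballot ks) (subst PositiveSuffixSums (sym v≡) pos)
    where
    ks = map deficit v
    v≡ : map ofDeficit ks ≡ v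
    v≡ = map-ofDeficit∘deficit hi
    S≡1 : sumℤ (map ofDeficit ks) ≡ 1ℤ
    S≡1 = trans (cong sumℤ v≡) Σ≡1
  from-ballot : ∀ {ks} → sum ks ≡ n × Ballot ks → HeightConditions n PositiveSuffixSums (map ofDeficit ks)
  from-ballot {ks} (Σ≡n , b) =
    map⁺ (All.map (λ k≤n → ℤ.+-monoʳ-≤ 1ℤ (ℤ.neg-mono-≤ (ℤ.+≤+ k≤n)))
                  (subst (λ t → All (_≤ t) ks) Σ≡n (All-≤-sum ks))) ,
    map⁺ (All.universal (λ k → ℤ.i-j≤i 1ℤ (ℤ.+ k)) ks) ,
    i+k≡j+k⇒i≡j (ℤ.+ n)
      (subst (λ t → sumℤ (map ofDeficit ks) ℤ.+ ℤ.+ t ≡ ℤ.+ suc n) Σ≡n (sumℤ-map-ofDeficit ks)) ,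
    ⇔.from (PositiveSuffixSums-ofDeficit⇔Ballot ks) b

heights↔ : ∀ n → Heights n PositivePrefixSums ↔ Fin (catalan n)
heights↔ n = ↔-trans (reverse-heights↔ n) (↔-trans (deficit-heights↔ n)
  (subst (λ k → BallotVec (suc n) n ↔ Fin k) (ballot[1+n,n]≡catalan n) (ballotVec↔ (suc n) n)))

WidthConditions : ∀ {n} → ℕ → Vec ℕ (suc n) → Set
WidthConditions m v = All (1 ≤_) v × All (_≤ m ∸ 1) v × sum v ≡ m

Widths : ℕ → ℕ → Set
Widths n m = Σ (Vec ℕ (suc n)) (WidthConditions m)

WidthConditions-irrelevant : ∀ {n m} (v : Vec ℕ (suc n)) → Irrelevant (WidthConditions m v)
WidthConditions-irrelevant _ =
  ×-irrelevant (All.irrelevant ≤-irrelevant) (×-irrelevant (All.irrelevant ≤-irrelevant) ≡-irrelevant)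

-- The bound x ≤ m - 1 on each x-step holds automatically; this is where 1 ≤ n is needed.
widths↔ : ∀ {n m} → 1 ≤ n → suc n ≤ m → Widths n m ↔ Fin ((m ∸ 1) C n)
widths↔ {n} {m} 1≤n 1+n≤m = ↔-trans
  (restrict↔ WidthConditions-irrelevant (λ _ → ≡-irrelevant) (map pred) (map suc)
     to-composition from-composition
     (λ (pos , _) → map-suc∘pred pos) (λ _ → trans (sym (map-∘ pred suc _)) (map-id _)))
  (subst (λ k → Composition (suc n) s ↔ Fin (k C n)) (cong (_∸ 1) 1+n+s≡m) (composition↔ n s))
  where
  s = m ∸ suc n
  1+n+s≡m : suc n + s ≡ m
  1+n+s≡m = m+[n∸m]≡n 1+n≤m
  to-composition : ∀ {v} → WidthConditions m v → sum (map pred v) ≡ s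
  to-composition {v} (pos , _ , Σ≡m) = +-cancelˡ-≡ (suc n) _ _ (begin
    suc n + sum (map pred v)   ≡⟨ sum-map-suc (map pred v) ⟨
    sum (map suc (map pred v)) ≡⟨ cong sum (map-suc∘pred pos) ⟩
    sum v                      ≡⟨ trans Σ≡m (sym 1+n+s≡m) ⟩
    suc n + s                  ∎)
  from-composition : ∀ {w} → sum w ≡ s → WidthConditions m (map suc w)
  from-composition {w} Σ≡s =
    map⁺ (All.universal (λ _ → s≤s z≤n) w) ,
    map⁺ (All.map (λ {k} k≤s → subst (suc k ≤_) (cong (_∸ 1) 1+n+s≡m) (+-mono-≤ 1≤n k≤s))
                  (subst (λ t → All (_≤ t) w) Σ≡s (All-≤-sum w))) ,
    trans (sum-map-suc w) (trans (cong (suc n +_) Σ≡s) 1+n+s≡m)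

PRML≡0↔RML≡0 : ∀ n m →
  Σ (PointedPath n m) (λ Ṗ → PRML Ṗ ≡ 0) ↔ Σ (LatticePath n m) (λ P → RML P ≡ 0)
PRML≡0↔RML≡0 n m = mk↔ₛ′ to from to∘from from∘to
  where
  to : Σ (PointedPath n m) (λ Ṗ → PRML Ṗ ≡ 0) → Σ (LatticePath n m) (λ P → RML P ≡ 0)
  to ([ P ︔ _ , _ ] , e) = P , m+n≡0⇒m≡0 (RML P) e
  from : Σ (LatticePath n m) (λ P → RML P ≡ 0) → Σ (PointedPath n m) (λ Ṗ → PRML Ṗ ≡ 0)
  from (P , e) = [ P ︔ 0 , All-last (xs-lo P) ] , trans (+-identityʳ (RML P)) e
  to∘from : ∀ x → to (from x) ≡ x
  to∘from _ = proj₁-injective (λ _ → ≡-irrelevant) refl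
  from∘to : ∀ x → from (to x) ≡ x
  from∘to ([ P ︔ j , j< ] , e) with m+n≡0⇒n≡0 (RML P) e
  ... | refl = proj₁-injective (λ _ → ≡-irrelevant) (cong [ P ︔ 0 ,_] (<-irrelevant _ j<))

RML≡0↔Widths×Heights : ∀ n m →
  Σ (LatticePath n m) (λ P → RML P ≡ 0) ↔ (Widths n m × Heights n PositivePrefixSums)
RML≡0↔Widths×Heights n m = mk↔ₛ′ to from to∘from from∘to
  where
  to : Σ (LatticePath n m) (λ P → RML P ≡ 0) → Widths n m × Heights n PositivePrefixSums
  to (P , e) = (xs P , xs-lo P , xs-hi P , xs-sum P) ,
               (ys P , ys-lo P , ys-hi P , ys-sum P , ⇔.to (RML≡0⇔PositivePrefixSums P) e)
  toPath : Widths n m × Heights n PositivePrefixSums → LatticePath n m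
  toPath ((v , x-lo , x-hi , x-sum) , (w , y-lo , y-hi , y-sum , _)) = record
    { xs = v ; xs-lo = x-lo ; xs-hi = x-hi ; xs-sum = x-sum
    ; ys = w ; ys-lo = y-lo ; ys-hi = y-hi ; ys-sum = y-sum }
  from : Widths n m × Heights n PositivePrefixSums → Σ (LatticePath n m) (λ P → RML P ≡ 0)
  from c@(_ , (_ , _ , _ , _ , pos)) = toPath c , ⇔.from (RML≡0⇔PositivePrefixSums (toPath c)) pos
  to∘from : ∀ c → to (from c) ≡ c
  to∘from (widths , _) =
    cong (widths ,_) (proj₁-injective (HeightConditions-irrelevant PositivePrefixSums-irrelevant) refl)
  from∘to : ∀ P → from (to P) ≡ P
  from∘to _ = proj₁-injective (λ _ → ≡-irrelevant) refl

lemma3p10 : (n m : ℕ) → 1 ≤ n → n + 1 ≤ m →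
    Σ (PointedPath n m) (λ Ṗ → PRML Ṗ ≡ 0) ↔ Fin (((m ∸ 1) C n) * catalan n)
lemma3p10 n m 1≤n n+1≤m =
  ↔-trans (PRML≡0↔RML≡0 n m)
    (↔-trans (RML≡0↔Widths×Heights n m)
      (↔-trans (widths↔ 1≤n (subst (_≤ m) (+-comm n 1) n+1≤m) ×-↔ heights↔ n) (↔-sym *↔×)))
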